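{- Let $d>1$, $\varepsilon>0$, $r\ge1$, let $G\in Gr_d$ be $(\varepsilon,r)$-uniform and let $F$ be an induced subgraph of $G$. Then $F$ is $(\varepsilon,2r)$-uniform relative to $G$, i.e. there exists $\tilde f:V(F)\to\operatorname{Prob}(F)$ such that $\|\tilde f(x)-\tilde f(y)\|_1\le\varepsilon$ for every pair of adjacent vertices $x,y\in V(F)$, and $\operatorname{Supp}(\tilde f(x))\subset B_{2r}(x,G)$ for every $x\in V(F)$.
   Context: $Gr_d$ is the set of finite simple graphs of maximum degree at most $d$. $B_s(x,G)$ is the set of vertices of $G$ at shortest-path distance at most $s$ from $x$. $\operatorname{Prob}(F)$ is the set of probability measures on $V(F)$, $\|f\|_1=\sum_x|f(x)|$, $\operatorname{Supp}(\mu)=\{z:\mu(z)\neq 0\}$. $G$ is $(\varepsilon,r)$-uniform if there is $\tilde g:V(G)\to\operatorname{Prob}(G)$ with $\|\tilde g(x)-\tilde g(y)\|_1<\varepsilon$ for all adjacent $x,y\in V(G)$ and $\operatorname{Supp}(\tilde g(x))\subset B_r(x,G)$ for all $x$.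
   Formalization: The parameter ε is rational, and the probability measures in $\operatorname{Prob}(G)$ and $\operatorname{Prob}(F)$, for both $\tilde g$ and $\tilde f$, take values in ℚ. -}

module Defs where

open import Data.Nat using (ℕ; zero; suc; _≤_)
open import Data.Fin using (Fin; zero; suc)
open import Data.Bool using (Bool; true; false; if_then_else_)
open import Data.Product using (Σ; _×_; _,_)
open import Data.Rational using (ℚ; 0ℚ; 1ℚ; _+_; _-_; ∣_∣; _<_; _≤_)
open import Relation.Binary.PropositionalEquality using (_≡_; _≢_)
open import Function.Definitions using (Injective)

sumℕ : ∀ {n} → (Fin n → ℕ) → ℕ
sumℕ {zero} f = 0
sumℕ {suc n} f = f zero Data.Nat.+ sumℕ (λ i → f (suc i))

sumℚ : ∀ {n} → (Fin n → ℚ) → ℚ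
sumℚ {zero} f = 0ℚ
sumℚ {suc n} f = f zero + sumℚ (λ i → f (suc i))

record Graph : Set where
  field
    n         : ℕ
    adj       : Fin n → Fin n → Bool
    adj-sym   : ∀ x y → adj x y ≡ adj y x
    adj-irrefl : ∀ x → adj x x ≡ false
open Graph public

V : Graph → Set
V G = Fin (n G)

Adj : (G : Graph) → V G → V G → Set
Adj G x y = adj G x y ≡ true

degree : (G : Graph) → V G → ℕ
degree G x = sumℕ (λ y → if adj G x y then 1 else 0)

MaxDegree≤ : Graph → ℕ → Set
MaxDegree≤ G d = ∀ x → degree G x Data.Nat.≤ d

-- Within G s x z : there is a walk of length ≤ s from x to z,
-- i.e. dist_G(x,z) ≤ s, i.e. z ∈ B_s(x,G)
data Within (G : Graph) : ℕ → V G → V G → Set where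
  here : ∀ {s x} → Within G s x x
  step : ∀ {s x y z} → Adj G x y → Within G s y z → Within G (suc s) x z

Prob : ℕ → Set
Prob m = Σ (Fin m → ℚ) (λ μ → (∀ z → 0ℚ Data.Rational.≤ μ z) × (sumℚ μ ≡ 1ℚ))

‖_-_‖₁ : ∀ {m} → Prob m → Prob m → ℚ
‖ (μ , _) - (ν , _) ‖₁ = sumℚ (λ z → ∣ μ z - ν z ∣)

mass : ∀ {m} → Prob m → Fin m → ℚ
mass (μ , _) z = μ z

Uniform : Graph → ℚ → ℕ → Set
Uniform G ε r =
  Σ (V G → Prob (n G)) λ g →
    (∀ x y → Adj G x y → ‖ g x - g y ‖₁ < ε) ×
    (∀ x z → mass (g x) z ≢ 0ℚ → Within G r x z)

record InducedSubgraph (F G : Graph) : Set where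
  field
    ι        : V F → V G
    ι-inj    : Injective _≡_ _≡_ ι
    ι-adj    : ∀ a b → adj F a b ≡ adj G (ι a) (ι b)
open InducedSubgraph public

RelUniform : (F G : Graph) → InducedSubgraph F G → ℚ → ℕ → Set
RelUniform F G emb ε s =
  Σ (V F → Prob (n F)) λ f →
    (∀ x y → Adj F x y → ‖ f x - f y ‖₁ Data.Rational.≤ ε) ×
    (∀ x z → mass (f x) z ≢ 0ℚ → Within G s (ι emb x) (ι emb z))

-- For x ∈ V(F), push the measure g(x) forward along a retraction φ : V(G) → V(F) sending each
-- vertex of G to a vertex of F within distance r of it (whenever one exists). Pushforward does
-- not increase ℓ¹ distances, so the ε-bound on adjacent vertices survives; and the support of
-- the pushed measure at x consists of points φ z with d(x, z) ≤ r, so d(x, φ z) ≤ 2r.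
module Submission where

open import Defs
open import Data.Nat using (ℕ; _*_; _<_; _≤_)
open import Data.Rational using (ℚ; 0ℚ)
import Data.Rational

import Data.Nat as ℕ
import Data.Nat.Properties as ℕ
open import Data.Fin using (Fin; zero; suc; _≟_)
open import Data.Fin.Properties using (any?)
open import Data.Bool using (true; false; if_then_else_)
import Data.Bool as Bool
open import Data.Product using (_×_; _,_; proj₁; ∃)
open import Relation.Nullary using (Dec; yes; no; does; ¬?; contradiction)
open import Relation.Nullary.Decidable using (_×-dec_)
open import Relation.Unary using (Pred; Decidable)
open import Relation.Binary.PropositionalEquality
open import Data.Rational using (_+_; _-_; -_; ∣_∣) renaming (_≤_ to _≤ℚ_)
import Data.Rational.Properties as ℚ
open import Algebra.Bundles using (CommutativeMonoid)
open import Algebra.Properties.CommutativeSemigroup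
  (CommutativeMonoid.commutativeSemigroup ℚ.+-0-commutativeMonoid) using (interchange)

module _ (G : Graph) where

  Within-mono : ∀ {s t x z} → s ≤ t → Within G s x z → Within G t x z
  Within-mono _         here       = here
  Within-mono (ℕ.s≤s p) (step a w) = step a (Within-mono p w)

  Within-snoc : ∀ {s x y z} → Within G s x y → Adj G y z → Within G (ℕ.suc s) x z
  Within-snoc here       a = step a here
  Within-snoc (step b w) a = step b (Within-snoc w a)

  Within-sym : ∀ {s x z} → Within G s x z → Within G s z x
  Within-sym here                        = here
  Within-sym {x = x} (step {y = y} a w) = Within-snoc (Within-sym w) (trans (adj-sym G y x) a)

  Within-trans : ∀ {s t x y z} → Within G s x y → Within G t y z → Within G (s ℕ.+ t) x z
  Within-trans {s} {t} here w' = Within-mono (ℕ.m≤n+m t s) w'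
  Within-trans (step a w) w'   = step a (Within-trans w w')

  Within? : ∀ s x z → Dec (Within G s x z)
  Within? s x z with x ≟ z
  ... | yes refl = yes here
  Within? ℕ.zero    x z | no x≢z = no λ { here → x≢z refl }
  Within? (ℕ.suc s) x z | no x≢z
    with any? (λ y → (adj G x y Bool.≟ true) ×-dec Within? s y z)
  ... | yes (_ , a , w) = yes (step a w)
  ... | no ¬path        = no λ { here → x≢z refl ; (step a w) → ¬path (_ , a , w) }

sumℚ-cong : ∀ {n} {f g : Fin n → ℚ} → (∀ i → f i ≡ g i) → sumℚ f ≡ sumℚ g
sumℚ-cong {ℕ.zero}  f≡g = refl
sumℚ-cong {ℕ.suc n} f≡g = cong₂ _+_ (f≡g zero) (sumℚ-cong (λ i → f≡g (suc i)))

sumℚ-0 : ∀ n → sumℚ {n} (λ _ → 0ℚ) ≡ 0ℚ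
sumℚ-0 ℕ.zero    = refl
sumℚ-0 (ℕ.suc n) = trans (ℚ.+-identityˡ _) (sumℚ-0 n)

sumℚ-distrib-+ : ∀ {n} (f g : Fin n → ℚ) → sumℚ (λ i → f i + g i) ≡ sumℚ f + sumℚ g
sumℚ-distrib-+ {ℕ.zero}  f g = refl
sumℚ-distrib-+ {ℕ.suc n} f g =
  trans (cong (f zero + g zero +_) (sumℚ-distrib-+ (λ i → f (suc i)) (λ i → g (suc i))))
        (interchange (f zero) (g zero) (sumℚ (λ i → f (suc i))) (sumℚ (λ i → g (suc i))))

sumℚ-distrib-neg : ∀ {n} (f : Fin n → ℚ) → sumℚ (λ i → - f i) ≡ - sumℚ f
sumℚ-distrib-neg {ℕ.zero}  f = refl
sumℚ-distrib-neg {ℕ.suc n} f =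
  trans (cong (- f zero +_) (sumℚ-distrib-neg (λ i → f (suc i))))
        (sym (ℚ.neg-distrib-+ (f zero) (sumℚ (λ i → f (suc i)))))

sumℚ-distrib-- : ∀ {n} (f g : Fin n → ℚ) → sumℚ (λ i → f i - g i) ≡ sumℚ f - sumℚ g
sumℚ-distrib-- f g = trans (sumℚ-distrib-+ f (λ i → - g i)) (cong (sumℚ f +_) (sumℚ-distrib-neg g))

sumℚ-swap : ∀ {n m} (h : Fin n → Fin m → ℚ) →
  sumℚ (λ i → sumℚ (h i)) ≡ sumℚ (λ j → sumℚ (λ i → h i j))
sumℚ-swap {ℕ.zero}  {m} h = sym (sumℚ-0 m)
sumℚ-swap {ℕ.suc n}     h =
  trans (cong (sumℚ (h zero) +_) (sumℚ-swap (λ i → h (suc i))))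
        (sym (sumℚ-distrib-+ (h zero) (λ j → sumℚ (λ i → h (suc i) j))))

sumℚ-mono-≤ : ∀ {n} {f g : Fin n → ℚ} → (∀ i → f i ≤ℚ g i) → sumℚ f ≤ℚ sumℚ g
sumℚ-mono-≤ {ℕ.zero}  f≤g = ℚ.≤-refl
sumℚ-mono-≤ {ℕ.suc n} f≤g = ℚ.+-mono-≤ (f≤g zero) (sumℚ-mono-≤ (λ i → f≤g (suc i)))

sumℚ-nonneg : ∀ {n} {f : Fin n → ℚ} → (∀ i → 0ℚ ≤ℚ f i) → 0ℚ ≤ℚ sumℚ f
sumℚ-nonneg {n} {f} f≥0 = subst (_≤ℚ sumℚ f) (sumℚ-0 n) (sumℚ-mono-≤ f≥0)

∣sumℚ∣≤sumℚ∣∣ : ∀ {n} (f : Fin n → ℚ) → ∣ sumℚ f ∣ ≤ℚ sumℚ (λ i → ∣ f i ∣)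
∣sumℚ∣≤sumℚ∣∣ {ℕ.zero}  f = ℚ.≤-refl
∣sumℚ∣≤sumℚ∣∣ {ℕ.suc n} f =
  ℚ.≤-trans (ℚ.∣p+q∣≤∣p∣+∣q∣ (f zero) (sumℚ (λ i → f (suc i))))
            (ℚ.+-mono-≤ (ℚ.≤-refl {∣ f zero ∣}) (∣sumℚ∣≤sumℚ∣∣ (λ i → f (suc i))))

single : ∀ {k} → Fin k → ℚ → Fin k → ℚ
single c a w = if does (c ≟ w) then a else 0ℚ

sumℚ-single : ∀ {k} (c : Fin k) a → sumℚ (single c a) ≡ a
sumℚ-single {ℕ.suc k} zero a =
  trans (cong (a +_) (sumℚ-0 k)) (ℚ.+-identityʳ a)
sumℚ-single {ℕ.suc k} (suc c) a =
  trans (ℚ.+-identityˡ _) (trans (sumℚ-cong shift) (sumℚ-single c a))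
  where
  shift : ∀ i → single (suc c) a (suc i) ≡ single c a i
  shift i with c ≟ i
  ... | yes _ = refl
  ... | no  _ = refl

single-distrib-- : ∀ {k} (c w : Fin k) a b → single c a w - single c b w ≡ single c (a - b) w
single-distrib-- c w a b with does (c ≟ w)
... | true  = refl
... | false = refl

∣single∣ : ∀ {k} (c w : Fin k) a → ∣ single c a w ∣ ≡ single c ∣ a ∣ w
∣single∣ c w a with does (c ≟ w)
... | true  = refl
... | false = refl

single-nonneg : ∀ {k} (c w : Fin k) {a} → 0ℚ ≤ℚ a → 0ℚ ≤ℚ single c a w
single-nonneg c w a≥0 with does (c ≟ w)
... | true  = a≥0
... | false = ℚ.≤-refl

module Pushforward {m k : ℕ} (φ : Fin m → Fin k) where

  push : (Fin m → ℚ) → Fin k → ℚ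
  push μ w = sumℚ (λ z → single (φ z) (μ z) w)

  sumℚ-push : ∀ μ → sumℚ (push μ) ≡ sumℚ μ
  sumℚ-push μ = trans (sumℚ-swap (λ w z → single (φ z) (μ z) w))
                      (sumℚ-cong (λ z → sumℚ-single (φ z) (μ z)))

  push-distrib-- : ∀ μ ν w → push μ w - push ν w ≡ push (λ z → μ z - ν z) w
  push-distrib-- μ ν w =
    trans (sym (sumℚ-distrib-- (λ z → single (φ z) (μ z) w) (λ z → single (φ z) (ν z) w)))
          (sumℚ-cong (λ z → single-distrib-- (φ z) w (μ z) (ν z)))

  ∣push∣≤push∣∣ : ∀ h w → ∣ push h w ∣ ≤ℚ push (λ z → ∣ h z ∣) w
  ∣push∣≤push∣∣ h w = ℚ.≤-trans (∣sumℚ∣≤sumℚ∣∣ (λ z → single (φ z) (h z) w))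
                                 (ℚ.≤-reflexive (sumℚ-cong (λ z → ∣single∣ (φ z) w (h z))))

  push-contracts : ∀ μ ν →
    sumℚ (λ w → ∣ push μ w - push ν w ∣) ≤ℚ sumℚ (λ z → ∣ μ z - ν z ∣)
  push-contracts μ ν = begin
    sumℚ (λ w → ∣ push μ w - push ν w ∣)       ≡⟨ sumℚ-cong (λ w → cong ∣_∣ (push-distrib-- μ ν w)) ⟩
    sumℚ (λ w → ∣ push (λ z → μ z - ν z) w ∣)  ≤⟨ sumℚ-mono-≤ (∣push∣≤push∣∣ (λ z → μ z - ν z)) ⟩
    sumℚ (push (λ z → ∣ μ z - ν z ∣))          ≡⟨ sumℚ-push (λ z → ∣ μ z - ν z ∣) ⟩
    sumℚ (λ z → ∣ μ z - ν z ∣)                 ∎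
    where open ℚ.≤-Reasoning

  push-vanishes : ∀ μ w → (∀ z → φ z ≡ w → μ z ≡ 0ℚ) → push μ w ≡ 0ℚ
  push-vanishes μ w μ≡0 = trans (sumℚ-cong term≡0) (sumℚ-0 m)
    where
    term≡0 : ∀ z → single (φ z) (μ z) w ≡ 0ℚ
    term≡0 z with φ z ≟ w
    ... | yes φz≡w = μ≡0 z φz≡w
    ... | no  _    = refl

  push-support : ∀ μ w → push μ w ≢ 0ℚ → ∃ λ z → φ z ≡ w × μ z ≢ 0ℚ
  push-support μ w push≢0 with any? (λ z → (φ z ≟ w) ×-dec ¬? (μ z ℚ.≟ 0ℚ))
  ... | yes witness = witness
  ... | no ¬witness = contradiction (push-vanishes μ w μ≡0) push≢0
    where
    μ≡0 : ∀ z → φ z ≡ w → μ z ≡ 0ℚ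
    μ≡0 z φz≡w with μ z ℚ.≟ 0ℚ
    ... | yes μz≡0 = μz≡0
    ... | no  μz≢0 = contradiction (z , φz≡w , μz≢0) ¬witness

  pushProb : Prob m → Prob k
  pushProb (μ , μ≥0 , sumμ≡1) =
    push μ , (λ w → sumℚ-nonneg (λ z → single-nonneg (φ z) w (μ≥0 z))) , trans (sumℚ-push μ) sumμ≡1

Fin? : ∀ n → Dec (Fin n)
Fin? ℕ.zero    = no λ ()
Fin? (ℕ.suc n) = yes zero

pick : ∀ {n p} {P : Pred (Fin n) p} → Decidable P → Fin n → Fin n
pick P? default with any? P?
... | yes (a , _) = a
... | no  _       = default

pick-satisfies : ∀ {n p} {P : Pred (Fin n) p} (P? : Decidable P) default {a} → P a → P (pick P? default)
pick-satisfies P? default {a} Pa with any? P?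
... | yes (_ , Pb) = Pb
... | no  ¬∃P      = contradiction (a , Pa) ¬∃P

module _ {F G : Graph} (emb : InducedSubgraph F G) where

  pushforward-relUniform : ∀ {ε r s} → Uniform G ε r → (φ : V G → V F) →
    (∀ x z → Within G r (ι emb x) z → Within G s z (ι emb (φ z))) →
    RelUniform F G emb ε (r ℕ.+ s)
  pushforward-relUniform {ε} {r} {s} (g , g-close , g-supp) φ φ-near = f , f-close , f-supp
    where
    open Pushforward φ
    f : V F → Prob (n F)
    f x = pushProb (g (ι emb x))
    f-close : ∀ x y → Adj F x y → ‖ f x - f y ‖₁ ≤ℚ ε
    f-close x y xy = ℚ.≤-trans (push-contracts (proj₁ (g (ι emb x))) (proj₁ (g (ι emb y))))
                       (ℚ.<⇒≤ (g-close (ι emb x) (ι emb y) (trans (sym (ι-adj emb x y)) xy)))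
    f-supp : ∀ x w → mass (f x) w ≢ 0ℚ → Within G (r ℕ.+ s) (ι emb x) (ι emb w)
    f-supp x w fxw≢0 with push-support (proj₁ (g (ι emb x))) w fxw≢0
    ... | z , refl , gxz≢0 = Within-trans G x↝z (φ-near x z x↝z)
      where x↝z = g-supp (ι emb x) z gxz≢0

  retraction : ℕ → V F → V G → V F
  retraction r default z = pick (λ a → Within? G r z (ι emb a)) default

  retraction-near : ∀ r default x z →
    Within G r (ι emb x) z → Within G r z (ι emb (retraction r default z))
  retraction-near r default x z x↝z =
    pick-satisfies (λ a → Within? G r z (ι emb a)) default (Within-sym G x↝z)

lemma7p2 : (d : ℕ) → 1 < d → (ε : ℚ) → 0ℚ Data.Rational.< ε → (r : ℕ) → 1 ≤ r →
    (G : Graph) → MaxDegree≤ G d → Uniform G ε r →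
    (F : Graph) → (emb : InducedSubgraph F G) → RelUniform F G emb ε (2 * r)
lemma7p2 _ _ ε _ r _ G _ uniform F emb with Fin? (n F)
... | no ¬vertex = (λ x → contradiction x ¬vertex) , (λ x → contradiction x ¬vertex)
                                                  , (λ x → contradiction x ¬vertex)
... | yes vertex = subst (RelUniform F G emb ε) r+r≡2r
                     (pushforward-relUniform emb uniform (retraction emb r vertex)
                                             (retraction-near emb r vertex))
  where
  r+r≡2r : r ℕ.+ r ≡ 2 * r
  r+r≡2r = cong (r ℕ.+_) (sym (ℕ.+-identityʳ r))
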